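{- Let $i\ge 2$ and let $c_0,\dots,c_{i-1}$ be the vertices of a cycle in cyclic order, with positive integer weights $w(c_0),\dots,w(c_{i-1})$. Consider the following procedure: initialize $b_{OPT}\gets 0$, a FIFO queue $Q_1$ empty and a FIFO queue $Q_2=(c_0,c_1,\dots,c_{i-1})$ (head $c_0$). Repeat the following loop body until $c_0$ becomes the head of $Q_1$ for the second time (i.e. $c_0$ has been head of $Q_1$, has been removed from $Q_1$, and is again head of $Q_1$): update $b_{OPT}\gets\max\{b_{OPT},\min\{w(Q_1),w(Q_2)\}\}$; then if $w(Q_1)>w(Q_2)$, dequeue the head of $Q_1$ and append it to the tail of $Q_2$, otherwise dequeue the head of $Q_2$ and append it to the tail of $Q_1$. Here $w(Q)$ denotes the sum of weights of the elements currently in $Q$. Then during the execution of this procedure, each vertex $c_j$, $0\le j\le i-1$, is dequeued from $Q_1$ at least once.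
   Context: A queue supports appending an element at its tail and removing the element at its head (dequeue). -}

module Defs where

open import Data.Nat using (ℕ; zero; suc; _+_; _<_; _<ᵇ_)
open import Data.Fin using (Fin)
open import Data.List using (List; []; _∷_; _++_; [_]; allFin; map)
open import Data.Nat.ListAction using (sum)
open import Data.Product using (_×_; _,_; proj₁; proj₂; ∃-syntax)
open import Data.Bool using (Bool; true; false; if_then_else_)
open import Relation.Binary.PropositionalEquality using (_≡_)
open import Relation.Nullary using (¬_)

-- A queue is a list: head = first element, tail = last element.
Queue : ℕ → Set
Queue i = List (Fin i)

wQ : ∀ {i} → (Fin i → ℕ) → Queue i → ℕ
wQ w Q = sum (map w Q)

State : ℕ → Set
State i = Queue i × Queue i

q1Heavier : ∀ {i} → (Fin i → ℕ) → State i → Bool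
q1Heavier w (Q₁ , Q₂) = wQ w Q₂ <ᵇ wQ w Q₁

-- dequeue head of first queue and append it to the tail of the second
-- (an empty source queue is left unchanged; this never happens for positive weights)
move : ∀ {i} → Queue i → Queue i → Queue i × Queue i
move []       to = [] , to
move (x ∷ xs) to = xs , to ++ [ x ]

-- one execution of the loop body (the b_OPT update does not affect the queues)
step : ∀ {i} → (Fin i → ℕ) → State i → State i
step w (Q₁ , Q₂) =
  if q1Heavier w (Q₁ , Q₂)
  then move Q₁ Q₂
  else (let r = move Q₂ Q₁ in proj₂ r , proj₁ r)

init : ∀ i → State i
init i = [] , allFin i

-- state before the (t+1)-st execution of the loop body
stateAt : ∀ {i} → (Fin i → ℕ) → ℕ → State i
stateAt {i} w zero    = init i
stateAt {i} w (suc t) = step w (stateAt w t)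

dequeuedFromQ1At : ∀ {i} → (Fin i → ℕ) → ℕ → Fin i → Set
dequeuedFromQ1At w t v =
  ∃[ rest ] (proj₁ (stateAt w t) ≡ v ∷ rest × q1Heavier w (stateAt w t) ≡ true)

-- stopping condition checked before the body at time t:
-- c₀ is head of Q₁ and has been dequeued from Q₁ before
-- (i.e. c₀ is head of Q₁ for the second time)
stopsAt : ∀ {i} → (Fin i → ℕ) → Fin i → ℕ → Set
stopsAt w c₀ t =
  ∃[ rest ] (proj₁ (stateAt w t) ≡ c₀ ∷ rest)
  × ∃[ s ] (s < t × dequeuedFromQ1At w s c₀)

runningAt : ∀ {i} → (Fin i → ℕ) → Fin i → ℕ → Set
runningAt w c₀ t = ∀ t′ → t′ Data.Nat.≤ t → ¬ stopsAt w c₀ t′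

c0 : ∀ {i} → 2 Data.Nat.≤ i → Fin i
c0 (Data.Nat.s≤s _) = Data.Fin.zero

-- Let k count the heads dequeued from Q₁ so far. A Q₂-move only shifts the
-- boundary between the queues and a Q₁-move rotates Q₁ ++ Q₂ by one, so
-- Q₁ ++ Q₂ is always the k-th rotation of (c₀, …, c_{i-1}); hence, while
-- k < i, a non-empty Q₁ has head c_k. With positive weights a non-empty Q₁
-- beats an empty Q₂, so every run of Q₂-moves ends after at most |Q₂| steps,
-- and k takes every value below i at some Q₁-move, which dequeues c_k. While
-- k < i no vertex is head of Q₁ both before and after a Q₁-dequeue, so the
-- procedure has not stopped yet.
module Submission where

open import Defs
open import Data.Nat using (ℕ; zero; suc; _≤_; _<_; _≤′_; ≤′-refl; ≤′-step; s≤s; NonZero; >-nonZero⁻¹)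
open import Data.Nat.Properties
  using (≤-refl; ≤-trans; n≤1+n; <⇒≤; ≤-<-trans; <-trans; <-irrefl; +-comm; ≤⇒≤′; suc-injective)
import Data.Fin as Fin
open Fin using (Fin; toℕ; fromℕ<)
open import Data.Fin.Properties using (toℕ-fromℕ<; toℕ<n; toℕ-injective)
open import Data.List using (List; []; _∷_; _++_; [_]; _∷ʳ_; length; drop; take; tabulate; allFin)
open import Data.List.Properties using (++-assoc; ++-identityʳ; length-++; length-tabulate; ∷-injectiveˡ)
open import Data.Product using (_×_; _,_; proj₁; proj₂; ∃-syntax)
open import Data.Bool using (true; false)
open import Function using (id; _∘_)
open import Relation.Binary.PropositionalEquality using (_≡_; refl; sym; trans; cong; subst; module ≡-Reasoning)
open import Relation.Nullary using (¬_)

private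
  variable
    A : Set

rotate₁ : List A → List A
rotate₁ []       = []
rotate₁ (x ∷ xs) = xs ∷ʳ x

rotate : ℕ → List A → List A
rotate zero    xs = xs
rotate (suc k) xs = rotate₁ (rotate k xs)

length-rotate₁ : (xs : List A) → length (rotate₁ xs) ≡ length xs
length-rotate₁ []       = refl
length-rotate₁ (x ∷ xs) = trans (length-++ xs) (+-comm (length xs) 1)

length-rotate : ∀ k (xs : List A) → length (rotate k xs) ≡ length xs
length-rotate zero    xs = refl
length-rotate (suc k) xs = trans (length-rotate₁ (rotate k xs)) (length-rotate k xs)

drop-∷-take-∷ʳ : ∀ (xs : List A) {k} → k < length xs →
                 ∃[ y ] (drop k xs ≡ y ∷ drop (suc k) xs × take (suc k) xs ≡ take k xs ∷ʳ y)
drop-∷-take-∷ʳ (x ∷ xs) {zero}  _         = x , refl , refl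
drop-∷-take-∷ʳ (x ∷ xs) {suc k} (s≤s k<n) with drop-∷-take-∷ʳ xs k<n
... | y , drop-eq , take-eq = y , drop-eq , cong (x ∷_) take-eq

rotate≡drop++take : ∀ k (xs : List A) → k ≤ length xs → rotate k xs ≡ drop k xs ++ take k xs
rotate≡drop++take zero    xs _   = sym (++-identityʳ xs)
rotate≡drop++take (suc k) xs k<n with drop-∷-take-∷ʳ xs k<n
... | y , drop-eq , take-eq = begin
  rotate₁ (rotate k xs)                     ≡⟨ cong rotate₁ (rotate≡drop++take k xs (<⇒≤ k<n)) ⟩
  rotate₁ (drop k xs ++ take k xs)          ≡⟨ cong (λ ys → rotate₁ (ys ++ take k xs)) drop-eq ⟩
  (drop (suc k) xs ++ take k xs) ∷ʳ y       ≡⟨ ++-assoc (drop (suc k) xs) (take k xs) [ y ] ⟩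
  drop (suc k) xs ++ (take k xs ∷ʳ y)       ≡⟨ cong (drop (suc k) xs ++_) (sym take-eq) ⟩
  drop (suc k) xs ++ take (suc k) xs        ∎
  where open ≡-Reasoning

drop-tabulate : ∀ {n} (f : Fin n → A) {k} (k<n : k < n) →
                drop k (tabulate f) ≡ f (fromℕ< k<n) ∷ drop (suc k) (tabulate f)
drop-tabulate {n = suc n} f {zero}  _         = refl
drop-tabulate {n = suc n} f {suc k} (s≤s k<n) = drop-tabulate (f ∘ Fin.suc) k<n

rotate-tabulate : ∀ {n} (f : Fin n → A) {k} (k<n : k < n) →
                  ∃[ ys ] (rotate k (tabulate f) ≡ f (fromℕ< k<n) ∷ ys)
rotate-tabulate f {k} k<n = _ , trans
  (rotate≡drop++take k (tabulate f) (subst (k ≤_) (sym (length-tabulate f)) (<⇒≤ k<n)))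
  (cong (_++ take k (tabulate f)) (drop-tabulate f k<n))

module _ {i : ℕ} (w : Fin i → ℕ) where

  contents : State i → Queue i
  contents (Q₁ , Q₂) = Q₁ ++ Q₂

  queue₁-heavier-∷ : ∀ s → q1Heavier w s ≡ true → ∃[ x ] ∃[ rest ] (proj₁ s ≡ x ∷ rest)
  queue₁-heavier-∷ (x ∷ rest , _) _ = x , rest , refl

  contents-step-heavier : ∀ s → q1Heavier w s ≡ true → contents (step w s) ≡ rotate₁ (contents s)
  contents-step-heavier (x ∷ xs , Q₂) h rewrite h = sym (++-assoc xs Q₂ [ x ])

  contents-step-lighter : ∀ s → q1Heavier w s ≡ false → contents (step w s) ≡ contents s
  contents-step-lighter (Q₁ , [])     h rewrite h = refl
  contents-step-lighter (Q₁ , y ∷ ys) h rewrite h = ++-assoc Q₁ [ y ] ys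

  dequeues : ℕ → ℕ
  dequeues zero    = 0
  dequeues (suc t) with q1Heavier w (stateAt w t)
  ... | true  = suc (dequeues t)
  ... | false = dequeues t

  dequeues-suc-heavier : ∀ t → q1Heavier w (stateAt w t) ≡ true → dequeues (suc t) ≡ suc (dequeues t)
  dequeues-suc-heavier t h with q1Heavier w (stateAt w t)
  dequeues-suc-heavier t refl | true = refl

  dequeues-suc-lighter : ∀ t → q1Heavier w (stateAt w t) ≡ false → dequeues (suc t) ≡ dequeues t
  dequeues-suc-lighter t h with q1Heavier w (stateAt w t)
  dequeues-suc-lighter t refl | false = refl

  dequeues-≤-suc : ∀ t → dequeues t ≤ dequeues (suc t)
  dequeues-≤-suc t with q1Heavier w (stateAt w t)
  ... | true  = n≤1+n (dequeues t)
  ... | false = ≤-refl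

  dequeues-mono : ∀ {t t′} → t ≤ t′ → dequeues t ≤ dequeues t′
  dequeues-mono = mono ∘ ≤⇒≤′
    where
    mono : ∀ {t t′} → t ≤′ t′ → dequeues t ≤ dequeues t′
    mono ≤′-refl               = ≤-refl
    mono (≤′-step {t′} t≤′t′) = ≤-trans (mono t≤′t′) (dequeues-≤-suc t′)

  contents-stateAt : ∀ t → contents (stateAt w t) ≡ rotate (dequeues t) (allFin i)
  contents-stateAt zero = refl
  contents-stateAt (suc t) = contents-next (q1Heavier w (stateAt w t)) refl
    where
    rotate-allFin : ∀ {k k′} → k ≡ k′ → rotate k (allFin i) ≡ rotate k′ (allFin i)
    rotate-allFin = cong (λ k → rotate k (allFin i))

    contents-next : ∀ b → q1Heavier w (stateAt w t) ≡ b →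
                    contents (stateAt w (suc t)) ≡ rotate (dequeues (suc t)) (allFin i)
    contents-next true h = trans (contents-step-heavier (stateAt w t) h)
      (trans (cong rotate₁ (contents-stateAt t)) (rotate-allFin (sym (dequeues-suc-heavier t h))))
    contents-next false h = trans (contents-step-lighter (stateAt w t) h)
      (trans (contents-stateAt t) (rotate-allFin (sym (dequeues-suc-lighter t h))))

  length-contents-stateAt : ∀ t → length (contents (stateAt w t)) ≡ i
  length-contents-stateAt t = begin
    length (contents (stateAt w t))            ≡⟨ cong length (contents-stateAt t) ⟩
    length (rotate (dequeues t) (allFin i))    ≡⟨ length-rotate (dequeues t) (allFin i) ⟩
    length (allFin i)                          ≡⟨ length-tabulate id ⟩
    i                                          ∎
    where open ≡-Reasoning

  head-queue₁ : ∀ t {x rest} → dequeues t < i → proj₁ (stateAt w t) ≡ x ∷ rest → toℕ x ≡ dequeues t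
  head-queue₁ t {x} {rest} k<i Q₁≡x∷rest with rotate-tabulate id k<i
  ... | ys , rotate≡ = begin
    toℕ x                   ≡⟨ cong toℕ (∷-injectiveˡ x∷≡) ⟩
    toℕ (fromℕ< k<i)        ≡⟨ toℕ-fromℕ< k<i ⟩
    dequeues t              ∎
    where
    open ≡-Reasoning
    x∷≡ : x ∷ (rest ++ proj₂ (stateAt w t)) ≡ fromℕ< k<i ∷ ys
    x∷≡ = trans (cong (_++ proj₂ (stateAt w t)) (sym Q₁≡x∷rest)) (trans (contents-stateAt t) rotate≡)

  not-stopped : ∀ {t} → dequeues t < i → ∀ v → ¬ stopsAt w v t
  not-stopped {t} k<i v (rest , Q₁≡v∷rest , s , s<t , rest′ , Q₁≡v∷rest′ , h) = <-irrefl same earlier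
    where
    earlier : dequeues s < dequeues t
    earlier = subst (_≤ dequeues t) (dequeues-suc-heavier s h) (dequeues-mono s<t)

    same : dequeues s ≡ dequeues t
    same = trans (sym (head-queue₁ s (<-trans earlier k<i) Q₁≡v∷rest′)) (head-queue₁ t k<i Q₁≡v∷rest)

  module _ (w-pos : ∀ v → 0 < w v) .{{_ : NonZero i}} where

    q1Heavier-∷-[] : ∀ x xs → q1Heavier w (x ∷ xs , []) ≡ true
    q1Heavier-∷-[] x xs with w x | w-pos x
    ... | suc _ | _ = refl

    length-queue₂-step-lighter : ∀ s → 0 < length (contents s) →
                                 q1Heavier w s ≡ false → suc (length (proj₂ (step w s))) ≡ length (proj₂ s)
    length-queue₂-step-lighter (x ∷ xs , []) _ h with () ← trans (sym h) (q1Heavier-∷-[] x xs)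
    length-queue₂-step-lighter (Q₁ , y ∷ ys) _ h rewrite h = refl

    length-queue₂-stateAt-lighter : ∀ t → q1Heavier w (stateAt w t) ≡ false →
                                    suc (length (proj₂ (stateAt w (suc t)))) ≡ length (proj₂ (stateAt w t))
    length-queue₂-stateAt-lighter t = length-queue₂-step-lighter (stateAt w t)
      (subst (0 <_) (sym (length-contents-stateAt t)) (>-nonZero⁻¹ i))

    heavier-within : ∀ m t → length (proj₂ (stateAt w t)) ≡ m →
                     ∃[ t′ ] (dequeues t′ ≡ dequeues t × q1Heavier w (stateAt w t′) ≡ true)
    heavier-within m t len with q1Heavier w (stateAt w t) in h
    heavier-within m       t len | true  = t , refl , h
    heavier-within zero    t len | false with () ← trans (length-queue₂-stateAt-lighter t h) len
    heavier-within (suc m) t len | false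
      with heavier-within m (suc t) (suc-injective (trans (length-queue₂-stateAt-lighter t h) len))
    ... | t′ , same , h′ = t′ , trans same (dequeues-suc-lighter t h) , h′

    heavier-with-dequeues : ∀ k → ∃[ t ] (dequeues t ≡ k × q1Heavier w (stateAt w t) ≡ true)
    heavier-with-dequeues zero = heavier-within _ zero refl
    heavier-with-dequeues (suc k) with heavier-with-dequeues k
    ... | t , refl , h with heavier-within _ (suc t) refl
    ...   | t′ , same , h′ = t′ , trans same (dequeues-suc-heavier t h) , h′

    each-vertex-dequeued : ∀ v → ∃[ t ] (dequeues t ≡ toℕ v × dequeuedFromQ1At w t v)
    each-vertex-dequeued v with heavier-with-dequeues (toℕ v)
    ... | t , dt , h with queue₁-heavier-∷ (stateAt w t) h
    ...   | x , rest , Q₁≡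
      with refl ← toℕ-injective (trans (head-queue₁ t (subst (_< i) (sym dt) (toℕ<n v)) Q₁≡) dt)
      = t , dt , rest , Q₁≡ , h

lemma4 : (i : ℕ) (i≥2 : 2 ≤ i) (w : Fin i → ℕ) → (∀ v → 0 < w v) →
         ∀ (j : Fin i) → ∃[ t ] (runningAt w (c0 i≥2) t × dequeuedFromQ1At w t j)
lemma4 (suc i) i≥2 w w-pos j with each-vertex-dequeued w w-pos j
... | t , dt , dequeued = t , running , dequeued
  where
  running : runningAt w (c0 i≥2) t
  running t′ t′≤t = not-stopped w
    (≤-<-trans (dequeues-mono w t′≤t) (subst (_< suc i) (sym dt) (toℕ<n j))) (c0 i≥2)
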